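{- Let $q$ be a prime power and let $f\colon\mathbb{F}_q^n\to\mathbb{F}_q$ be a polynomial of degree $d$. Assume there exists an affine subspace $u_0+U$ of dimension $k$ (with $U$ a linear subspace) such that $f$ restricted to $u_0+U$ has degree at most $d-1$. Then for every $u_1\in\mathbb{F}_q^n$, the degree of $f$ restricted to $u_1+U$ is at most $d-1$.
   Context: For an affine subspace $W\subseteq\mathbb{F}_q^n$, the degree of $f$ restricted to $W$ is the minimal degree of a polynomial $\mathbb{F}_q^n\to\mathbb{F}_q$ that agrees with $f$ on $W$; degrees are of the reduced representation with individual degrees at most $q-1$. -}

module Defs where

open import Level using (0ℓ)
open import Algebra.Bundles using (CommutativeRing)
open import Data.Nat as ℕ using (ℕ; zero; suc)
open import Data.Fin using (Fin; zero; suc)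
open import Data.List using (List; []; _∷_)
open import Data.Product using (Σ; ∃; _×_; _,_)
open import Relation.Binary.PropositionalEquality using (_≡_)
open import Relation.Nullary using (¬_)

module Over (R : CommutativeRing 0ℓ 0ℓ) where
  open CommutativeRing R using (Carrier; _≈_; _+_; _*_; 0#; 1#)

  IsField : Set
  IsField = (¬ (1# ≈ 0#)) × (∀ x → ¬ (x ≈ 0#) → ∃ λ y → (x * y) ≈ 1#)

  HasSize : ℕ → Set
  HasSize q = Σ (Fin q → Carrier) λ e →
                (∀ i j → e i ≈ e j → i ≡ j) × (∀ x → ∃ λ i → e i ≈ x)

  Vec : ℕ → Set
  Vec n = Fin n → Carrier

  sumF : ∀ {k} → (Fin k → Carrier) → Carrier
  sumF {zero}  t = 0#
  sumF {suc k} t = t zero + sumF (λ i → t (suc i))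

  prodF : ∀ {k} → (Fin k → Carrier) → Carrier
  prodF {zero}  t = 1#
  prodF {suc k} t = t zero * prodF (λ i → t (suc i))

  pow : Carrier → ℕ → Carrier
  pow x zero    = 1#
  pow x (suc e) = x * pow x e

  totDeg : ∀ {n} → (Fin n → ℕ) → ℕ
  totDeg {zero}  e = 0
  totDeg {suc n} e = e zero ℕ.+ totDeg (λ i → e (suc i))

  Poly : ℕ → Set
  Poly n = List (Carrier × (Fin n → ℕ))

  eval : ∀ {n} → Poly n → Vec n → Carrier
  eval []             x = 0#
  eval ((c , e) ∷ ps) x = c * prodF (λ i → pow (x i) (e i)) + eval ps x

  -- Reduced (individual degrees ≤ q-1) and every monomial has total degree < d.
  -- In particular for d = 0 the polynomial is the empty sum, i.e. zero.
  ReducedDegLt : ∀ {n} → ℕ → ℕ → Poly n → Set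
  ReducedDegLt q d []             = Data.Unit.⊤
    where import Data.Unit
  ReducedDegLt q d ((c , e) ∷ ps) =
    (∀ i → e i ℕ.< q) × (totDeg e ℕ.< d) × ReducedDegLt q d ps

  affPt : ∀ {n k} → Vec n → (Fin k → Vec n) → (Fin k → Carrier) → Vec n
  affPt u b t i = u i + sumF (λ j → t j * b j i)

  -- b_1..b_k are linearly independent, so span(b) is a k-dimensional linear subspace.
  LinIndep : ∀ {n k} → (Fin k → Vec n) → Set
  LinIndep {n} {k} b = ∀ (t : Fin k → Carrier) → (∀ (i : Fin n) → sumF (λ j → t j * b j i) ≈ 0#) → ∀ j → t j ≈ 0#

  -- "deg (f restricted to u + span b) < d" (equivalently ≤ d-1, with the zero
  -- function having degree -∞): some reduced polynomial of degree < d agrees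
  -- with f on every point of u + span b.
  RestrDegLt : ∀ {n k} → ℕ → (Vec n → Carrier) → Vec n → (Fin k → Vec n) → ℕ → Set
  RestrDegLt {n} q f u b d = Σ (Poly n) λ P → ReducedDegLt q d P ×
                               (∀ t → f (affPt u b t) ≈ eval P (affPt u b t))

  DegLt : ∀ {n} → ℕ → (Vec n → Carrier) → ℕ → Set
  DegLt {n} q f d = Σ (Poly n) λ P → ReducedDegLt q d P × (∀ x → f x ≈ eval P x)

  HasDeg : ∀ {n} → ℕ → (Vec n → Carrier) → ℕ → Set
  HasDeg q f d = DegLt q f (suc d) × ¬ DegLt q f d

-- Put w = u₀ − u₁ and let P, Q be reduced polynomials with f = P everywhere
-- (deg P ≤ d) and f = Q on u₀ + U (deg Q < d). The finite difference
-- Δ_w g (x) = g (x + w) − g (x) of a polynomial of degree ≤ d has degree < d,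
-- and expanding (x + w)^e never raises an individual exponent. Since
-- y ↦ y + w maps u₁ + U onto u₀ + U, on u₁ + U we get
--   f (y) = P (y + w) − Δ_w P (y) = Q (y + w) − Δ_w P (y) = Q (y) + Δ_w Q (y) − Δ_w P (y),
-- a reduced polynomial of degree < d.
module Submission where

open import Defs
open import Level using (0ℓ)
open import Algebra.Bundles using (CommutativeRing)
open import Data.Nat using (ℕ; suc; _^_)
open import Data.Nat.Primality using (Prime)
open import Data.Fin using (Fin)
open import Data.Product using (∃; ∃₂; _×_)
open import Relation.Binary.PropositionalEquality using (_≡_)

open import Function using (_∘_)
open import Data.Nat using (zero; _≤_; _<_; z≤n; s≤s)
import Data.Nat.Properties as ℕₚ
open import Data.Fin using (zero; suc)
open import Data.Product using (_,_; proj₁; proj₂)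
open import Data.Unit using (tt)
open import Data.List using (List; []; _∷_; _++_; map; cartesianProductWith)
open import Data.List.Relation.Unary.All as All using (All; []; _∷_)
open import Data.List.Relation.Unary.All.Properties using (++⁺; map⁺; cartesianProductWith⁺)
import Data.Vec.Functional as V
import Relation.Binary.PropositionalEquality as ≡

module _ (R : CommutativeRing 0ℓ 0ℓ) where
  open Over R
  open CommutativeRing R hiding (zero)
  open import Algebra.Properties.Group +-group using (x≈z//y; //-rightDividesˡ)
  open import Algebra.Properties.Ring ring using (-0#≈0#; -‿distribˡ-*)
  open import Algebra.Properties.AbelianGroup +-abelianGroup using (⁻¹-∙-comm)
  open import Algebra.Properties.CommutativeSemigroup +-commutativeSemigroup
    using () renaming (interchange to +-interchange; xy∙z≈zx∙y to +-rotate)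
  open import Algebra.Properties.CommutativeSemigroup *-commutativeSemigroup
    using () renaming (interchange to *-interchange; x∙yz≈y∙xz to *-leftSwap)
  open import Relation.Binary.Reasoning.Setoid setoid

  pow-cong : ∀ m {x y} → x ≈ y → pow x m ≈ pow y m
  pow-cong zero    x≈y = refl
  pow-cong (suc m) x≈y = *-cong x≈y (pow-cong m x≈y)

  prodF-cong : ∀ {k} {s t : Fin k → Carrier} → (∀ i → s i ≈ t i) → prodF s ≈ prodF t
  prodF-cong {zero}  s≈t = refl
  prodF-cong {suc k} s≈t = *-cong (s≈t zero) (prodF-cong (s≈t ∘ suc))

  eval-cong : ∀ {n} (p : Poly n) {x y : Vec n} → (∀ i → x i ≈ y i) → eval p x ≈ eval p y
  eval-cong []            x≈y = refl
  eval-cong ((c , e) ∷ p) x≈y =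
    +-cong (*-congˡ (prodF-cong λ i → pow-cong (e i) (x≈y i))) (eval-cong p x≈y)

  eval-++ : ∀ {n} (p r : Poly n) x → eval (p ++ r) x ≈ eval p x + eval r x
  eval-++ []            r x = sym (+-identityˡ _)
  eval-++ ((c , e) ∷ p) r x = trans (+-congˡ (eval-++ p r x)) (sym (+-assoc _ _ _))

  scale : ∀ {n} → Carrier → Poly n → Poly n
  scale c = map λ (c′ , e) → (c * c′ , e)

  eval-scale : ∀ {n} c (p : Poly n) x → eval (scale c p) x ≈ c * eval p x
  eval-scale c []             x = sym (zeroʳ c)
  eval-scale c ((c′ , e) ∷ p) x =
    trans (+-cong (*-assoc _ _ _) (eval-scale c p x)) (sym (distribˡ _ _ _))

  negate : ∀ {n} → Poly n → Poly n
  negate = map λ (c , e) → (- c , e)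

  eval-negate : ∀ {n} (p : Poly n) x → eval (negate p) x ≈ - eval p x
  eval-negate []            x = sym -0#≈0#
  eval-negate ((c , e) ∷ p) x =
    trans (+-cong (sym (-‿distribˡ-* c _)) (eval-negate p x)) (⁻¹-∙-comm _ _)

  UPoly : Set
  UPoly = List (Carrier × ℕ)

  evalU : UPoly → Carrier → Carrier
  evalU []            y = 0#
  evalU ((c , j) ∷ p) y = c * pow y j + evalU p y

  evalU-++ : ∀ (p r : UPoly) y → evalU (p ++ r) y ≈ evalU p y + evalU r y
  evalU-++ []            r y = sym (+-identityˡ _)
  evalU-++ ((c , j) ∷ p) r y = trans (+-congˡ (evalU-++ p r y)) (sym (+-assoc _ _ _))

  raise : UPoly → UPoly
  raise = map λ (c , j) → (c , suc j)

  evalU-raise : ∀ p y → evalU (raise p) y ≈ y * evalU p y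
  evalU-raise []            y = sym (zeroʳ y)
  evalU-raise ((c , j) ∷ p) y =
    trans (+-cong (*-leftSwap c y _) (evalU-raise p y)) (sym (distribˡ _ _ _))

  scaleU : Carrier → UPoly → UPoly
  scaleU w = map λ (c , j) → (w * c , j)

  evalU-scaleU : ∀ w p y → evalU (scaleU w p) y ≈ w * evalU p y
  evalU-scaleU w []            y = sym (zeroʳ w)
  evalU-scaleU w ((c , j) ∷ p) y =
    trans (+-cong (*-assoc _ _ _) (evalU-scaleU w p y)) (sym (distribˡ _ _ _))

  -- (y + w)^(m+1) = y · (y + w)^m + w · (y + w)^m
  binomialTail : ℕ → Carrier → UPoly
  binomialTail zero    w = []
  binomialTail (suc m) w = raise (binomialTail m w) ++ scaleU w ((1# , m) ∷ binomialTail m w)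

  pow-+-binomialTail : ∀ m w y → pow (y + w) m ≈ pow y m + evalU (binomialTail m w) y
  pow-+-binomialTail zero    w y = sym (+-identityʳ 1#)
  pow-+-binomialTail (suc m) w y = begin
    (y + w) * pow (y + w) m                   ≈⟨ distribʳ _ y w ⟩
    y * pow (y + w) m + w * pow (y + w) m     ≈⟨ +-cong (*-congˡ IH) (*-congˡ IH′) ⟩
    y * (pow y m + t) + w * evalU T′ y        ≈⟨ +-congʳ (distribˡ y _ t) ⟩
    (y * pow y m + y * t) + w * evalU T′ y    ≈⟨ +-assoc _ _ _ ⟩
    y * pow y m + (y * t + w * evalU T′ y)    ≈⟨ +-congˡ tail≈ ⟨
    y * pow y m + evalU (binomialTail (suc m) w) y ∎
    where
      T = binomialTail m w
      T′ = (1# , m) ∷ T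
      t = evalU T y
      IH = pow-+-binomialTail m w y
      IH′ : pow (y + w) m ≈ evalU T′ y
      IH′ = trans IH (+-congʳ (sym (*-identityˡ _)))
      tail≈ : evalU (binomialTail (suc m) w) y ≈ y * t + w * evalU T′ y
      tail≈ = trans (evalU-++ (raise T) _ y) (+-cong (evalU-raise T y) (evalU-scaleU w T′ y))

  binomialTail-deg : ∀ m w → All ((_< m) ∘ proj₂) (binomialTail m w)
  binomialTail-deg zero    w = []
  binomialTail-deg (suc m) w =
    ++⁺ (map⁺ (All.map s≤s IH)) (map⁺ (ℕₚ.≤-refl ∷ All.map ℕₚ.m<n⇒m<1+n IH))
    where IH = binomialTail-deg m w

  monomial : ∀ {n} → Vec n → (Fin n → ℕ) → Carrier
  monomial x e = prodF λ i → pow (x i) (e i)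

  mulTerm : ∀ {n} → Carrier × ℕ → Carrier × (Fin n → ℕ) → Carrier × (Fin (suc n) → ℕ)
  mulTerm (c , j) (c′ , a) = (c * c′ , j V.∷ a)

  headTimes : ∀ {n} → UPoly → Poly n → Poly (suc n)
  headTimes = cartesianProductWith mulTerm

  eval-map-mulTerm : ∀ {n} c j (r : Poly n) x →
                     eval (map (mulTerm (c , j)) r) x ≈ (c * pow (V.head x) j) * eval r (V.tail x)
  eval-map-mulTerm c j []             x = sym (zeroʳ _)
  eval-map-mulTerm c j ((c′ , a) ∷ r) x =
    trans (+-cong (*-interchange c c′ _ _) (eval-map-mulTerm c j r x)) (sym (distribˡ _ _ _))

  eval-headTimes : ∀ {n} B (r : Poly n) x → eval (headTimes B r) x ≈ evalU B (V.head x) * eval r (V.tail x)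
  eval-headTimes []            r x = sym (zeroˡ _)
  eval-headTimes ((c , j) ∷ B) r x = begin
    eval (map (mulTerm (c , j)) r ++ headTimes B r) x
      ≈⟨ eval-++ (map (mulTerm (c , j)) r) _ x ⟩
    eval (map (mulTerm (c , j)) r) x + eval (headTimes B r) x
      ≈⟨ +-cong (eval-map-mulTerm c j r x) (eval-headTimes B r x) ⟩
    c * pow (V.head x) j * eval r (V.tail x) + evalU B (V.head x) * eval r (V.tail x)
      ≈⟨ distribʳ _ _ _ ⟨
    evalU ((c , j) ∷ B) (V.head x) * eval r (V.tail x) ∎

  headTimes⁺ : ∀ {n} {P : Carrier × ℕ → Set} {Q : Carrier × (Fin n → ℕ) → Set}
               {S : Carrier × (Fin (suc n) → ℕ) → Set} B r →
               All P B → All Q r → (∀ {s t} → P s → Q t → S (mulTerm s t)) →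
               All S (headTimes B r)
  headTimes⁺ B r PB Qr PQ⇒S =
    cartesianProductWith⁺ (≡.setoid _) (≡.setoid _) mulTerm B r
      λ s∈B t∈r → PQ⇒S (All.lookup PB s∈B) (All.lookup Qr t∈r)

  infixl 6 _+ᵥ_
  _+ᵥ_ : ∀ {n} → Vec n → Vec n → Vec n
  (x +ᵥ w) i = x i + w i

  -- (x + w)^e = x₀^e₀ · (x′ + w′)^e′ + (binomial tail of e₀ in x₀) · (x′ + w′)^e′
  monomialTail : ∀ {n} → (Fin n → ℕ) → Vec n → Poly n
  monomialTail {zero}  e w = []
  monomialTail {suc n} e w =
    headTimes ((1# , V.head e) ∷ []) T ++
    headTimes (binomialTail (V.head e) (V.head w)) ((1# , V.tail e) ∷ T)
    where T = monomialTail (V.tail e) (V.tail w)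

  monomial-+ᵥ : ∀ {n} (e : Fin n → ℕ) w x → monomial (x +ᵥ w) e ≈ monomial x e + eval (monomialTail e w) x
  monomial-+ᵥ {zero}  e w x = sym (+-identityʳ 1#)
  monomial-+ᵥ {suc n} e w x = begin
    pow (x₀ + w₀) e₀ * monomial (x′ +ᵥ w′) e′
      ≈⟨ *-cong (pow-+-binomialTail e₀ w₀ x₀) (monomial-+ᵥ e′ w′ x′) ⟩
    (P + B) * (X + T)            ≈⟨ distribʳ _ P B ⟩
    P * (X + T) + B * (X + T)    ≈⟨ +-congʳ (distribˡ P X T) ⟩
    (P * X + P * T) + B * (X + T) ≈⟨ +-assoc _ _ _ ⟩
    P * X + (P * T + B * (X + T)) ≈⟨ +-congˡ tail≈ ⟨
    P * X + eval (monomialTail e w) x ∎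
    where
      e₀ = V.head e; e′ = V.tail e; w₀ = V.head w; w′ = V.tail w; x₀ = V.head x; x′ = V.tail x
      Tₚ = monomialTail e′ w′
      P = pow x₀ e₀
      B = evalU (binomialTail e₀ w₀) x₀
      X = monomial x′ e′
      T = eval Tₚ x′
      tail≈ : eval (monomialTail e w) x ≈ P * T + B * (X + T)
      tail≈ = begin
        eval (monomialTail e w) x
          ≈⟨ eval-++ (headTimes ((1# , e₀) ∷ []) Tₚ) _ x ⟩
        eval (headTimes ((1# , e₀) ∷ []) Tₚ) x + eval (headTimes (binomialTail e₀ w₀) ((1# , e′) ∷ Tₚ)) x
          ≈⟨ +-cong (eval-headTimes ((1# , e₀) ∷ []) Tₚ x) (eval-headTimes (binomialTail e₀ w₀) _ x) ⟩
        (1# * P + 0#) * T + B * (1# * X + T)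
          ≈⟨ +-cong (*-congʳ (trans (+-identityʳ _) (*-identityˡ P))) (*-congˡ (+-congʳ (*-identityˡ X))) ⟩
        P * T + B * (X + T) ∎

  Below : ∀ {n} → (Fin n → ℕ) → (Fin n → ℕ) → Set
  Below e a = (∀ i → a i ≤ e i) × totDeg a < totDeg e

  totDeg-mono-≤ : ∀ {n} {a e : Fin n → ℕ} → (∀ i → a i ≤ e i) → totDeg a ≤ totDeg e
  totDeg-mono-≤ {zero}  a≤e = z≤n
  totDeg-mono-≤ {suc n} a≤e = ℕₚ.+-mono-≤ (a≤e zero) (totDeg-mono-≤ (a≤e ∘ suc))

  ∷-≤ : ∀ {n j} {a : Fin n → ℕ} {e : Fin (suc n) → ℕ} →
        j ≤ V.head e → (∀ i → a i ≤ V.tail e i) → ∀ i → (j V.∷ a) i ≤ e i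
  ∷-≤ j≤e₀ a≤e′ zero    = j≤e₀
  ∷-≤ j≤e₀ a≤e′ (suc i) = a≤e′ i

  monomialTail-below : ∀ {n} (e : Fin n → ℕ) w → All (Below e ∘ proj₂) (monomialTail e w)
  monomialTail-below {zero}  e w = []
  monomialTail-below {suc n} e w =
    ++⁺ (headTimes⁺ ((1# , V.head e) ∷ []) T (ℕₚ.≤-refl ∷ []) IH
           λ j≤e₀ (a≤e′ , a<e′) → ∷-≤ j≤e₀ a≤e′ , ℕₚ.+-mono-≤-< j≤e₀ a<e′)
        (headTimes⁺ (binomialTail (V.head e) (V.head w)) ((1# , V.tail e) ∷ T)
           (binomialTail-deg (V.head e) (V.head w)) ((λ i → ℕₚ.≤-refl) ∷ All.map proj₁ IH)
           λ j<e₀ a≤e′ → ∷-≤ (ℕₚ.<⇒≤ j<e₀) a≤e′ , ℕₚ.+-mono-<-≤ j<e₀ (totDeg-mono-≤ a≤e′))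
    where
      T = monomialTail (V.tail e) (V.tail w)
      IH = monomialTail-below (V.tail e) (V.tail w)

  Δ : ∀ {n} → Poly n → Vec n → Poly n
  Δ []            w = []
  Δ ((c , e) ∷ p) w = scale c (monomialTail e w) ++ Δ p w

  eval-+ᵥ : ∀ {n} (p : Poly n) w x → eval p (x +ᵥ w) ≈ eval p x + eval (Δ p w) x
  eval-+ᵥ []            w x = sym (+-identityʳ 0#)
  eval-+ᵥ ((c , e) ∷ p) w x = begin
    c * monomial (x +ᵥ w) e + eval p (x +ᵥ w)  ≈⟨ +-cong (*-congˡ (monomial-+ᵥ e w x)) (eval-+ᵥ p w x) ⟩
    c * (M + T) + (E + D)                      ≈⟨ +-congʳ (distribˡ c M T) ⟩
    (c * M + c * T) + (E + D)                  ≈⟨ +-interchange _ _ _ _ ⟩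
    (c * M + E) + (c * T + D)                  ≈⟨ +-congˡ Δ≈ ⟨
    eval ((c , e) ∷ p) x + eval (Δ ((c , e) ∷ p) w) x ∎
    where
      M = monomial x e; T = eval (monomialTail e w) x; E = eval p x; D = eval (Δ p w) x
      Δ≈ : eval (Δ ((c , e) ∷ p) w) x ≈ c * T + D
      Δ≈ = trans (eval-++ (scale c (monomialTail e w)) _ x)
                 (+-congʳ (eval-scale c (monomialTail e w) x))

  ReducedBelow : ℕ → ℕ → ∀ {n} → (Fin n → ℕ) → Set
  ReducedBelow q d e = (∀ i → e i < q) × totDeg e < d

  ReducedDegLt⇒All : ∀ {n} q d (p : Poly n) → ReducedDegLt q d p → All (ReducedBelow q d ∘ proj₂) p
  ReducedDegLt⇒All q d []            _               = []
  ReducedDegLt⇒All q d ((c , e) ∷ p) (e<q , e<d , p-red) = (e<q , e<d) ∷ ReducedDegLt⇒All q d p p-red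

  All⇒ReducedDegLt : ∀ {n} q d (p : Poly n) → All (ReducedBelow q d ∘ proj₂) p → ReducedDegLt q d p
  All⇒ReducedDegLt q d []            []                  = tt
  All⇒ReducedDegLt q d ((c , e) ∷ p) ((e<q , e<d) ∷ p-red) = e<q , e<d , All⇒ReducedDegLt q d p p-red

  Δ-reducedBelow : ∀ {n} q d (p : Poly n) w →
                   All (ReducedBelow q (suc d) ∘ proj₂) p → All (ReducedBelow q d ∘ proj₂) (Δ p w)
  Δ-reducedBelow q d []            w []                   = []
  Δ-reducedBelow q d ((c , e) ∷ p) w ((e<q , e≤d) ∷ p-red) =
    ++⁺ (map⁺ (All.map (λ (a≤e , a<e) → (λ i → ℕₚ.≤-<-trans (a≤e i) (e<q i)) , ℕₚ.<-≤-trans a<e (ℕₚ.≤-pred e≤d))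
                       (monomialTail-below e w)))
        (Δ-reducedBelow q d p w p-red)

  affPt-translate : ∀ {n k} (u₀ u₁ : Vec n) (b : Fin k → Vec n) t i →
                    (affPt u₁ b t +ᵥ (λ j → u₀ j + - u₁ j)) i ≈ affPt u₀ b t i
  affPt-translate u₀ u₁ b t i =
    trans (+-rotate (u₁ i) _ _) (+-congʳ (//-rightDividesˡ (u₁ i) (u₀ i)))

  restrDegLt-translate : ∀ {n k} q d (f : Vec n → Carrier) → DegLt q f (suc d) →
                         (u₀ : Vec n) (b : Fin k → Vec n) → RestrDegLt q f u₀ b d →
                         (u₁ : Vec n) → RestrDegLt q f u₁ b d
  restrDegLt-translate q d f (P , P-red , f≈P) u₀ b (Q , Q-red , f≈Q) u₁ = S , S-red , f≈S
    where
      w = λ i → u₀ i + - u₁ i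
      S = (Q ++ Δ Q w) ++ negate (Δ P w)
      Q-below = ReducedDegLt⇒All q d Q Q-red
      S-red : ReducedDegLt q d S
      S-red = All⇒ReducedDegLt q d S
        (++⁺ (++⁺ Q-below (Δ-reducedBelow q d Q w (All.map (λ (e<q , e<d) → e<q , ℕₚ.m<n⇒m<1+n e<d) Q-below)))
             (map⁺ (Δ-reducedBelow q d P w (ReducedDegLt⇒All q (suc d) P P-red))))
      f≈S : ∀ t → f (affPt u₁ b t) ≈ eval S (affPt u₁ b t)
      f≈S t = begin
        f y                              ≈⟨ f≈P y ⟩
        eval P y                         ≈⟨ x≈z//y _ _ _ P+ΔP≈Q+ΔQ ⟩
        (eval Q y + eval (Δ Q w) y) + - eval (Δ P w) y
          ≈⟨ +-cong (eval-++ Q (Δ Q w) y) (eval-negate (Δ P w) y) ⟨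
        eval (Q ++ Δ Q w) y + eval (negate (Δ P w)) y ≈⟨ eval-++ (Q ++ Δ Q w) _ y ⟨
        eval S y ∎
        where
          y = affPt u₁ b t
          y+w = affPt-translate u₀ u₁ b t
          P+ΔP≈Q+ΔQ : eval P y + eval (Δ P w) y ≈ eval Q y + eval (Δ Q w) y
          P+ΔP≈Q+ΔQ = begin
            eval P y + eval (Δ P w) y ≈⟨ eval-+ᵥ P w y ⟨
            eval P (y +ᵥ w)           ≈⟨ eval-cong P y+w ⟩
            eval P (affPt u₀ b t)     ≈⟨ f≈P _ ⟨
            f (affPt u₀ b t)          ≈⟨ f≈Q t ⟩
            eval Q (affPt u₀ b t)     ≈⟨ eval-cong Q y+w ⟨
            eval Q (y +ᵥ w)           ≈⟨ eval-+ᵥ Q w y ⟩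
            eval Q y + eval (Δ Q w) y ∎

claim3p2 : (F : CommutativeRing 0ℓ 0ℓ) → let open Over F in
    IsField → (q : ℕ) → (∃₂ λ p m → Prime p × q ≡ p ^ suc m) → HasSize q →
    (n d k : ℕ) (f : Vec n → CommutativeRing.Carrier F) → HasDeg q f d →
    (u₀ : Vec n) (b : Fin k → Vec n) → LinIndep b →
    RestrDegLt q f u₀ b d →
    (u₁ : Vec n) → RestrDegLt q f u₁ b d
claim3p2 F _ q _ _ n d k f (deg-f≤d , _) u₀ b _ =
  restrDegLt-translate F q d f deg-f≤d u₀ b
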